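{- Let $A$ and $B$ be two disjoint sets. Then there exists a structure of pure and trivial double Boolean algebra on the set $\mathcal{P}(A)\cup\mathcal{P}(B)$.
   Context: $\mathcal{P}(X)$ denotes the power set of $X$. A double Boolean algebra (dBa) is an algebra $\underline{D}=(D;\sqcap,\sqcup,\neg,\lrcorner,\bot,\top)$ of type $(2,2,1,1,0,0)$ satisfying, for all $x,y,z$, where $x\vee y:=\neg(\neg x\sqcap\neg y)$ and $x\wedge y:=\lrcorner(\lrcorner x\sqcup\lrcorner y)$: $(x\sqcap x)\sqcap y=x\sqcap y$; $(x\sqcup x)\sqcup y=x\sqcup y$; $\sqcap$ and $\sqcup$ are commutative and associative; $x\sqcap(x\sqcup y)=x\sqcap x$; $x\sqcup(x\sqcap y)=x\sqcup x$; $x\sqcap(x\vee y)=x\sqcap x$; $x\sqcup(x\wedge y)=x\sqcup x$; $x\sqcap(y\vee z)=(x\sqcap y)\vee(x\sqcap z)$; $x\sqcup(y\wedge z)=(x\sqcup y)\wedge(x\sqcup z)$; $\neg\neg(x\sqcap y)=x\sqcap y$; $\lrcorner\lrcorner(x\sqcup y)=x\sqcup y$; $\neg(x\sqcap x)=\neg x$; $\lrcorner(x\sqcup x)=\lrcorner x$; $x\sqcap\neg x=\bot$; $x\sqcup\lrcorner x=\top$; $\neg\bot=\top\sqcap\top$; $\lrcorner\top=\bot\sqcup\bot$; $\neg\top=\bot$; $\lrcorner\bot=\top$; $(x\sqcap x)\sqcup(x\sqcap x)=(x\sqcup x)\sqcap(x\sqcup x)$. $\underline{D}$ is pure if every $x$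 satisfies $x\sqcap x=x$ or $x\sqcup x=x$, and trivial if $\top\sqcap\top=\bot\sqcup\bot$. -}

module Defs where

open import Level using (Level)
import Level
open import Data.Bool using (Bool; true; false)
open import Data.Sum using (_⊎_)
open import Data.Product using (Σ; _×_; _,_)
open import Relation.Binary.PropositionalEquality using (_≡_)
open import Relation.Binary.Core using (Rel)
open import Relation.Binary.Structures using (IsEquivalence)

record IsDBA {c ℓ : Level} {D : Set c} (_≈_ : Rel D ℓ)
             (_⊓_ _⊔_ : D → D → D) (¬_ ⌟_ : D → D) (⊥ ⊤ : D)
             : Set (c Level.⊔ ℓ) where
  _∨_ : D → D → D
  x ∨ y = ¬ ((¬ x) ⊓ (¬ y))
  _∧_ : D → D → D
  x ∧ y = ⌟ ((⌟ x) ⊔ (⌟ y))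
  field
    isEquivalence : IsEquivalence _≈_
    ⊓-cong : ∀ {x x′ y y′} → x ≈ x′ → y ≈ y′ → (x ⊓ y) ≈ (x′ ⊓ y′)
    ⊔-cong : ∀ {x x′ y y′} → x ≈ x′ → y ≈ y′ → (x ⊔ y) ≈ (x′ ⊔ y′)
    ¬-cong : ∀ {x x′} → x ≈ x′ → (¬ x) ≈ (¬ x′)
    ⌟-cong : ∀ {x x′} → x ≈ x′ → (⌟ x) ≈ (⌟ x′)
    ax1a : ∀ x y → ((x ⊓ x) ⊓ y) ≈ (x ⊓ y)
    ax1b : ∀ x y → ((x ⊔ x) ⊔ y) ≈ (x ⊔ y)
    ax2a : ∀ x y → (x ⊓ y) ≈ (y ⊓ x)
    ax2b : ∀ x y → (x ⊔ y) ≈ (y ⊔ x)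
    ax3a : ∀ x y z → (x ⊓ (y ⊓ z)) ≈ ((x ⊓ y) ⊓ z)
    ax3b : ∀ x y z → (x ⊔ (y ⊔ z)) ≈ ((x ⊔ y) ⊔ z)
    ax4a : ∀ x y → (x ⊓ (x ⊔ y)) ≈ (x ⊓ x)
    ax4b : ∀ x y → (x ⊔ (x ⊓ y)) ≈ (x ⊔ x)
    ax5a : ∀ x y → (x ⊓ (x ∨ y)) ≈ (x ⊓ x)
    ax5b : ∀ x y → (x ⊔ (x ∧ y)) ≈ (x ⊔ x)
    ax6a : ∀ x y z → (x ⊓ (y ∨ z)) ≈ ((x ⊓ y) ∨ (x ⊓ z))
    ax6b : ∀ x y z → (x ⊔ (y ∧ z)) ≈ ((x ⊔ y) ∧ (x ⊔ z))
    ax7a : ∀ x y → (¬ (¬ (x ⊓ y))) ≈ (x ⊓ y)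
    ax7b : ∀ x y → (⌟ (⌟ (x ⊔ y))) ≈ (x ⊔ y)
    ax8a : ∀ x → (¬ (x ⊓ x)) ≈ (¬ x)
    ax8b : ∀ x → (⌟ (x ⊔ x)) ≈ (⌟ x)
    ax9a : ∀ x → (x ⊓ (¬ x)) ≈ ⊥
    ax9b : ∀ x → (x ⊔ (⌟ x)) ≈ ⊤
    ax10a : (¬ ⊥) ≈ (⊤ ⊓ ⊤)
    ax10b : (⌟ ⊤) ≈ (⊥ ⊔ ⊥)
    ax11a : (¬ ⊤) ≈ ⊥
    ax11b : (⌟ ⊥) ≈ ⊤
    ax12 : ∀ x → ((x ⊓ x) ⊔ (x ⊓ x)) ≈ ((x ⊔ x) ⊓ (x ⊔ x))

record DBAStructure {c ℓ : Level} (D : Set c) (_≈_ : Rel D ℓ) : Set (c Level.⊔ ℓ) where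
  field
    _⊓_ _⊔_ : D → D → D
    ¬_ ⌟_ : D → D
    ⊥ ⊤ : D
    isDBA : IsDBA _≈_ _⊓_ _⊔_ ¬_ ⌟_ ⊥ ⊤

module _ {c ℓ : Level} {D : Set c} {_≈_ : Rel D ℓ} (S : DBAStructure D _≈_) where
  open DBAStructure S

  Pure : Set (c Level.⊔ ℓ)
  Pure = ∀ x → (x ⊓ x) ≈ x ⊎ (x ⊔ x) ≈ x

  Trivial : Set ℓ
  Trivial = (⊤ ⊓ ⊤) ≈ (⊥ ⊔ ⊥)

Subset : Set → Set
Subset X = X → Bool

_⊆_ : {X : Set} → Subset X → Subset X → Set
S ⊆ T = ∀ x → S x ≡ true → T x ≡ true

Disjoint : {X : Set} → Subset X → Subset X → Set
Disjoint A B = ∀ x → A x ≡ true → B x ≡ false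

PowUnion : {X : Set} → Subset X → Subset X → Set
PowUnion {X} A B = Σ (Subset X) (λ S → S ⊆ A ⊎ S ⊆ B)

_≐_ : {X : Set} {A B : Subset X} → Rel (PowUnion A B) Level.zero
(S , _) ≐ (T , _) = ∀ x → S x ≡ T x

{-# OPTIONS --safe #-}
module Submission where

-- Take x ⊓ y = A ∩ (x ∪ y), ¬ x = A ∖ x, ⊥ = A, and dually x ⊔ y = B ∩ (x ∪ y),
-- ⌟ x = B ∖ x, ⊤ = B.  These act coordinatewise, and the coordinate algebra on
-- Bool depends only on where the point lies: over A it is the order-reversed
-- Boolean algebra Bool (⊓ = ∨, ¬ = not, ⊥ = true) with the ⊔-half collapsed to
-- the constant false, over B its dual, and elsewhere everything is constantly
-- false.  Each is a double Boolean algebra, hence so is the product, and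
-- 𝒫(A) ∪ 𝒫(B) is closed under the operations.  Purity is x ⊓ x = A ∩ x = x on
-- 𝒫(A) (dually on 𝒫(B)), and triviality is ⊤ ⊓ ⊤ = A ∩ B = ⊥ ⊔ ⊥ = ∅.

open import Defs
open import Level using (Level)
open import Data.Product using (Σ; _×_; _,_; proj₁)
open import Data.Sum using (inj₁; inj₂)
open import Relation.Binary.Core using (Rel)
open import Relation.Binary.Structures using (IsEquivalence)
open import Algebra.Lattice.Bundles using (BooleanAlgebra)
import Algebra.Lattice.Properties.BooleanAlgebra as BooleanAlgebraProperties

private
  variable
    c ℓ : Level
    D : Set c

isDBA-dual : {_≈_ : Rel D ℓ} {_⊓_ _⊔_ : D → D → D} {¬_ ⌟_ : D → D} {⊥ ⊤ : D} →
             IsDBA _≈_ _⊓_ _⊔_ ¬_ ⌟_ ⊥ ⊤ → IsDBA _≈_ _⊔_ _⊓_ ⌟_ ¬_ ⊤ ⊥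
isDBA-dual d = record
  { isEquivalence = isEquivalence
  ; ⊓-cong = ⊔-cong ; ⊔-cong = ⊓-cong ; ¬-cong = ⌟-cong ; ⌟-cong = ¬-cong
  ; ax1a = ax1b ; ax1b = ax1a ; ax2a = ax2b ; ax2b = ax2a ; ax3a = ax3b ; ax3b = ax3a
  ; ax4a = ax4b ; ax4b = ax4a ; ax5a = ax5b ; ax5b = ax5a ; ax6a = ax6b ; ax6b = ax6a
  ; ax7a = ax7b ; ax7b = ax7a ; ax8a = ax8b ; ax8b = ax8a ; ax9a = ax9b ; ax9b = ax9a
  ; ax10a = ax10b ; ax10b = ax10a ; ax11a = ax11b ; ax11b = ax11a
  ; ax12 = λ x → IsEquivalence.sym isEquivalence (ax12 x)
  }
  where open IsDBA d

module _ (𝔹 : BooleanAlgebra c ℓ) where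
  open BooleanAlgebra 𝔹
  open BooleanAlgebraProperties 𝔹 using (∧-idem; ∧-identityʳ; ¬-involutive; deMorgan₁; ¬⊥≈⊤; ¬⊤≈⊥)
  open import Relation.Binary.Reasoning.Setoid setoid

  ¬∧¬≈∨ : ∀ x y → ¬ (¬ x ∧ ¬ y) ≈ x ∨ y
  ¬∧¬≈∨ x y = begin
    ¬ (¬ x ∧ ¬ y)      ≈⟨ deMorgan₁ (¬ x) (¬ y) ⟩
    ¬ ¬ x ∨ ¬ ¬ y      ≈⟨ ∨-cong (¬-involutive x) (¬-involutive y) ⟩
    x ∨ y              ∎

  booleanAlgebra⇒isDBA : IsDBA _≈_ _∧_ (λ _ _ → ⊤) ¬_ (λ _ → ⊤) ⊥ ⊤
  booleanAlgebra⇒isDBA = record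
    { isEquivalence = isEquivalence
    ; ⊓-cong = ∧-cong ; ⊔-cong = λ _ _ → refl ; ¬-cong = ¬-cong ; ⌟-cong = λ _ → refl
    ; ax1a = λ x y → ∧-cong (∧-idem x) refl
    ; ax1b = λ _ _ → refl
    ; ax2a = ∧-comm
    ; ax2b = λ _ _ → refl
    ; ax3a = λ x y z → sym (∧-assoc x y z)
    ; ax3b = λ _ _ _ → refl
    ; ax4a = λ x _ → trans (∧-identityʳ x) (sym (∧-idem x))
    ; ax4b = λ _ _ → refl
    ; ax5a = λ x y → begin
        x ∧ ¬ (¬ x ∧ ¬ y)  ≈⟨ ∧-congˡ (¬∧¬≈∨ x y) ⟩
        x ∧ (x ∨ y)        ≈⟨ ∧-absorbs-∨ x y ⟩
        x                  ≈⟨ ∧-idem x ⟨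
        x ∧ x              ∎
    ; ax5b = λ _ _ → refl
    ; ax6a = λ x y z → begin
        x ∧ ¬ (¬ y ∧ ¬ z)                  ≈⟨ ∧-congˡ (¬∧¬≈∨ y z) ⟩
        x ∧ (y ∨ z)                        ≈⟨ ∧-distribˡ-∨ x y z ⟩
        (x ∧ y) ∨ (x ∧ z)                  ≈⟨ ¬∧¬≈∨ (x ∧ y) (x ∧ z) ⟨
        ¬ (¬ (x ∧ y) ∧ ¬ (x ∧ z))          ∎
    ; ax6b = λ _ _ _ → refl
    ; ax7a = λ x y → ¬-involutive (x ∧ y)
    ; ax7b = λ _ _ → refl
    ; ax8a = λ x → ¬-cong (∧-idem x)
    ; ax8b = λ _ → refl
    ; ax9a = ∧-complementʳ
    ; ax9b = λ _ → refl
    ; ax10a = trans ¬⊥≈⊤ (sym (∧-idem ⊤))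
    ; ax10b = refl
    ; ax11a = ¬⊤≈⊥
    ; ax11b = refl
    ; ax12 = λ _ → sym (∧-idem ⊤)
    }

open import Data.Bool using (Bool; true; false; _∧_; _∨_; not)
open import Relation.Binary.PropositionalEquality using (_≡_; refl; sym; trans; cong; cong₂) renaming (isEquivalence to ≡-isEquivalence)
open import Data.Bool.Properties using (∨-∧-booleanAlgebra; ∧-conicalˡ; ∧-identityʳ; ∧-zeroʳ)
open BooleanAlgebraProperties ∨-∧-booleanAlgebra using (∧-∨-booleanAlgebra)

constant-isDBA : (z : D) → IsDBA _≡_ (λ _ _ → z) (λ _ _ → z) (λ _ → z) (λ _ → z) z z
constant-isDBA z = record
  { isEquivalence = ≡-isEquivalence
  ; ⊓-cong = λ _ _ → refl ; ⊔-cong = λ _ _ → refl ; ¬-cong = λ _ → refl ; ⌟-cong = λ _ → refl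
  ; ax1a = λ _ _ → refl ; ax1b = λ _ _ → refl ; ax2a = λ _ _ → refl ; ax2b = λ _ _ → refl
  ; ax3a = λ _ _ _ → refl ; ax3b = λ _ _ _ → refl ; ax4a = λ _ _ → refl ; ax4b = λ _ _ → refl
  ; ax5a = λ _ _ → refl ; ax5b = λ _ _ → refl ; ax6a = λ _ _ _ → refl ; ax6b = λ _ _ _ → refl
  ; ax7a = λ _ _ → refl ; ax7b = λ _ _ → refl ; ax8a = λ _ → refl ; ax8b = λ _ → refl
  ; ax9a = λ _ → refl ; ax9b = λ _ → refl
  ; ax10a = refl ; ax10b = refl ; ax11a = refl ; ax11b = refl
  ; ax12 = λ _ → refl
  }

disjoint-fibre-isDBA : ∀ a b → (a ≡ true → b ≡ false) →
  IsDBA _≡_ (λ u v → a ∧ (u ∨ v)) (λ u v → b ∧ (u ∨ v)) (λ u → a ∧ not u) (λ u → b ∧ not u) a b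
disjoint-fibre-isDBA true  true  a⇒¬b with () ← a⇒¬b refl
disjoint-fibre-isDBA true  false _ = booleanAlgebra⇒isDBA ∧-∨-booleanAlgebra
disjoint-fibre-isDBA false true  _ = isDBA-dual (booleanAlgebra⇒isDBA ∧-∨-booleanAlgebra)
disjoint-fibre-isDBA false false _ = constant-isDBA false

module _ {X : Set} where
  infixr 6 _∩_ _∖_
  infixr 5 _∪_

  _∩_ _∪_ _∖_ : Subset X → Subset X → Subset X
  (S ∩ T) p = S p ∧ T p
  (S ∪ T) p = S p ∨ T p
  (S ∖ T) p = S p ∧ not (T p)

  ∩-⊆ˡ : (S T : Subset X) → (S ∩ T) ⊆ S
  ∩-⊆ˡ S T p = ∧-conicalˡ (S p) (T p)

  ∖-⊆ˡ : (S T : Subset X) → (S ∖ T) ⊆ S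
  ∖-⊆ˡ S T p = ∧-conicalˡ (S p) (not (T p))

  ⊆⇒∩-∪-idem : {S T : Subset X} → S ⊆ T → ∀ p → (T ∩ (S ∪ S)) p ≡ S p
  ⊆⇒∩-∪-idem {S} {T} S⊆T p with S p in Sp≡true
  ... | true  = trans (∧-identityʳ (T p)) (S⊆T p Sp≡true)
  ... | false = ∧-zeroʳ (T p)

  disjoint⇒∩-∪-comm : {A B : Subset X} → Disjoint A B → ∀ p → (A ∩ (B ∪ B)) p ≡ (B ∩ (A ∪ A)) p
  disjoint⇒∩-∪-comm {A} {B} A∩B=∅ p with A p in Ap≡true
  ... | true  rewrite A∩B=∅ p Ap≡true = refl
  ... | false = sym (∧-zeroʳ (B p))

module PowUnionDBA {X : Set} (A B : Subset X) (A∩B=∅ : Disjoint A B) where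
  P : Set
  P = PowUnion A B

  _⊓_ _⊔_ : P → P → P
  (x , _) ⊓ (y , _) = A ∩ (x ∪ y) , inj₁ (∩-⊆ˡ A (x ∪ y))
  (x , _) ⊔ (y , _) = B ∩ (x ∪ y) , inj₂ (∩-⊆ˡ B (x ∪ y))

  ¬_ ⌟_ : P → P
  ¬ (x , _) = A ∖ x , inj₁ (∖-⊆ˡ A x)
  ⌟ (x , _) = B ∖ x , inj₂ (∖-⊆ˡ B x)

  ⊥ ⊤ : P
  ⊥ = A , inj₁ (λ _ Ap → Ap)
  ⊤ = B , inj₂ (λ _ Bp → Bp)

  isDBA : IsDBA _≐_ _⊓_ _⊔_ ¬_ ⌟_ ⊥ ⊤
  isDBA = record
    { isEquivalence = record
        { refl = λ _ → refl ; sym = λ x≐y p → sym (x≐y p) ; trans = λ x≐y y≐z p → trans (x≐y p) (y≐z p) }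
    ; ⊓-cong = λ x≐x′ y≐y′ p → cong₂ (λ u v → A p ∧ (u ∨ v)) (x≐x′ p) (y≐y′ p)
    ; ⊔-cong = λ x≐x′ y≐y′ p → cong₂ (λ u v → B p ∧ (u ∨ v)) (x≐x′ p) (y≐y′ p)
    ; ¬-cong = λ x≐x′ p → cong (λ u → A p ∧ not u) (x≐x′ p)
    ; ⌟-cong = λ x≐x′ p → cong (λ u → B p ∧ not u) (x≐x′ p)
    ; ax1a = λ x y p → ax1a (fibre p) (x ⟨ p ⟩) (y ⟨ p ⟩)
    ; ax1b = λ x y p → ax1b (fibre p) (x ⟨ p ⟩) (y ⟨ p ⟩)
    ; ax2a = λ x y p → ax2a (fibre p) (x ⟨ p ⟩) (y ⟨ p ⟩)
    ; ax2b = λ x y p → ax2b (fibre p) (x ⟨ p ⟩) (y ⟨ p ⟩)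
    ; ax3a = λ x y z p → ax3a (fibre p) (x ⟨ p ⟩) (y ⟨ p ⟩) (z ⟨ p ⟩)
    ; ax3b = λ x y z p → ax3b (fibre p) (x ⟨ p ⟩) (y ⟨ p ⟩) (z ⟨ p ⟩)
    ; ax4a = λ x y p → ax4a (fibre p) (x ⟨ p ⟩) (y ⟨ p ⟩)
    ; ax4b = λ x y p → ax4b (fibre p) (x ⟨ p ⟩) (y ⟨ p ⟩)
    ; ax5a = λ x y p → ax5a (fibre p) (x ⟨ p ⟩) (y ⟨ p ⟩)
    ; ax5b = λ x y p → ax5b (fibre p) (x ⟨ p ⟩) (y ⟨ p ⟩)
    ; ax6a = λ x y z p → ax6a (fibre p) (x ⟨ p ⟩) (y ⟨ p ⟩) (z ⟨ p ⟩)
    ; ax6b = λ x y z p → ax6b (fibre p) (x ⟨ p ⟩) (y ⟨ p ⟩) (z ⟨ p ⟩)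
    ; ax7a = λ x y p → ax7a (fibre p) (x ⟨ p ⟩) (y ⟨ p ⟩)
    ; ax7b = λ x y p → ax7b (fibre p) (x ⟨ p ⟩) (y ⟨ p ⟩)
    ; ax8a = λ x p → ax8a (fibre p) (x ⟨ p ⟩)
    ; ax8b = λ x p → ax8b (fibre p) (x ⟨ p ⟩)
    ; ax9a = λ x p → ax9a (fibre p) (x ⟨ p ⟩)
    ; ax9b = λ x p → ax9b (fibre p) (x ⟨ p ⟩)
    ; ax10a = λ p → ax10a (fibre p)
    ; ax10b = λ p → ax10b (fibre p)
    ; ax11a = λ p → ax11a (fibre p)
    ; ax11b = λ p → ax11b (fibre p)
    ; ax12 = λ x p → ax12 (fibre p) (x ⟨ p ⟩)
    }
    where
    open IsDBA hiding (_∨_; _∧_)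

    fibre : ∀ p → IsDBA _≡_ (λ u v → A p ∧ (u ∨ v)) (λ u v → B p ∧ (u ∨ v))
                            (λ u → A p ∧ not u) (λ u → B p ∧ not u) (A p) (B p)
    fibre p = disjoint-fibre-isDBA (A p) (B p) (A∩B=∅ p)

    _⟨_⟩ : P → X → Bool
    x ⟨ p ⟩ = proj₁ x p

  structure : DBAStructure P _≐_
  structure = record { _⊓_ = _⊓_ ; _⊔_ = _⊔_ ; ¬_ = ¬_ ; ⌟_ = ⌟_ ; ⊥ = ⊥ ; ⊤ = ⊤ ; isDBA = isDBA }

  pure : Pure structure
  pure (x , inj₁ x⊆A) = inj₁ (⊆⇒∩-∪-idem x⊆A)
  pure (x , inj₂ x⊆B) = inj₂ (⊆⇒∩-∪-idem x⊆B)

  trivial : Trivial structure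
  trivial = disjoint⇒∩-∪-comm A∩B=∅

corollary3p6 : (X : Set) (A B : Subset X) → Disjoint A B →
    Σ (DBAStructure (PowUnion A B) _≐_) (λ D → Pure D × Trivial D)
corollary3p6 X A B A∩B=∅ = structure , pure , trivial
  where open PowUnionDBA A B A∩B=∅
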